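{- Let $G$ be an $n$-vertex graph. (a) If $G$ has a connected component with an odd number of edges, then $\nu(G)=0$. (b) If every vertex of $G$ has odd degree, then $\nu(G)=0$. (c) If $G$ has a vertex $v$ of degree $n-1$, then $\nu(G)=0$ if $n$ is even, and $\nu(G)=\nu(G-v)$ if $n$ is odd.
   Context: For an $N$-vertex digraph $D$, a descent of a bijection $\sigma:V(D)\to[N]$ is an arc $u\to w$ with $\sigma(u)>\sigma(w)$, and $A_D(t)=\sum_\sigma t^{\mathrm{des}_D(\sigma)}$ where $\mathrm{des}_D(\sigma)$ counts descents. For a graph $G$, $\nu(G):=|A_D(-1)|$ for any orientation $D$ of $G$ (independent of orientation). -}

module Defs where

open import Data.Bool using (Bool; true; false; _∧_; _∨_; not; if_then_else_)
open import Data.Nat using (ℕ; zero; suc; _+_; _%_)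
open import Data.Fin using (Fin; zero; suc; toℕ; _<?_; punchIn)
import Data.Fin as F
open import Data.Fin.Properties using () renaming (_≟_ to _≟ᶠ_)
open import Data.List using (List; []; _∷_; map; concatMap; filter; foldr; allFin)
open import Data.Bool.ListAction using (and)
open import Data.Vec.Functional using () renaming (_∷_ to _∷ᶠ_)
open import Data.Integer using (ℤ; +_; -_; ∣_∣) renaming (_+_ to _+ℤ_)
open import Data.Product using (Σ; _×_; ∃-syntax)
open import Relation.Nullary using (does)
open import Relation.Binary.PropositionalEquality using (_≡_)

record Graph (n : ℕ) : Set where
  field
    adj    : Fin n → Fin n → Bool
    sym    : ∀ u v → adj u v ≡ adj v u
    irrefl : ∀ v → adj v v ≡ false
open Graph public

count : {A : Set} → (A → Bool) → List A → ℕ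
count p []       = 0
count p (x ∷ xs) = if p x then suc (count p xs) else count p xs

pairs : (n : ℕ) → List (Fin n × Fin n)
pairs n = concatMap (λ u → map (λ w → (u Data.Product., w)) (allFin n)) (allFin n)
  where import Data.Product

_<ᵇ_ : {n : ℕ} → Fin n → Fin n → Bool
u <ᵇ w = does (u <? w)

deg : {n : ℕ} → Graph n → Fin n → ℕ
deg {n} G v = count (λ w → adj G v w) (allFin n)

data Walk {n : ℕ} (G : Graph n) : Fin n → Fin n → Set where
  here : ∀ {u} → Walk G u u
  step : ∀ {u v w} → adj G u v ≡ true → Walk G v w → Walk G u w

IsComponent : {n : ℕ} → Graph n → (Fin n → Bool) → Set
IsComponent G C =
  (∃[ v ] C v ≡ true) ×
  (∀ u w → C u ≡ true → adj G u w ≡ true → C w ≡ true) ×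
  (∀ u w → C u ≡ true → C w ≡ true → Walk G u w)

edgesIn : {n : ℕ} → Graph n → (Fin n → Bool) → ℕ
edgesIn {n} G C =
  count (λ { (u Data.Product., w) → (u <ᵇ w) ∧ adj G u w ∧ C u ∧ C w }) (pairs n)
  where import Data.Product

Odd Even : ℕ → Set
Odd  k = k % 2 ≡ 1
Even k = k % 2 ≡ 0

HasOddComponent : {n : ℕ} → Graph n → Set
HasOddComponent {n} G = ∃[ C ] (IsComponent G C × Odd (edgesIn G C))

-- Bijections V(D) → [N] (enumerated as injective maps Fin n → Fin n)

allFuns : (n m : ℕ) → List (Fin n → Fin m)
allFuns zero    m = (λ ()) ∷ []
allFuns (suc n) m = concatMap (λ f → map (λ i → i ∷ᶠ f) (allFin m)) (allFuns n m)

isInjective : {n : ℕ} → (Fin n → Fin n) → Bool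
isInjective {n} f =
  and (map (λ { (i Data.Product., j) → does (i ≟ᶠ j) ∨ not (does (f i ≟ᶠ f j)) }) (pairs n))
  where import Data.Product

bijections : (n : ℕ) → List (Fin n → Fin n)
bijections n = filter (λ f → Data.Bool.T? (isInjective f)) (allFuns n n)
  where import Data.Bool

Digraph : ℕ → Set
Digraph n = Fin n → Fin n → Bool

des : {n : ℕ} → Digraph n → (Fin n → Fin n) → ℕ
des {n} D σ = count (λ { (u Data.Product., w) → D u w ∧ (σ w <ᵇ σ u) }) (pairs n)
  where import Data.Product

sign : ℕ → ℤ
sign zero    = + 1
sign (suc k) = - sign k

A-1 : {n : ℕ} → Digraph n → ℤ
A-1 {n} D = foldr (λ σ acc → sign (des D σ) +ℤ acc) (+ 0) (bijections n)

orient : {n : ℕ} → Graph n → Digraph n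
orient G u w = adj G u w ∧ (u <ᵇ w)

-- ν(G) = |A_D(-1)| for an (any) orientation D of G
ν : {n : ℕ} → Graph n → ℕ
ν G = ∣ A-1 (orient G) ∣

delete : {m : ℕ} → Graph (suc m) → Fin (suc m) → Graph m
delete G v = record
  { adj    = λ i j → adj G (punchIn v i) (punchIn v j)
  ; sym    = λ i j → sym G (punchIn v i) (punchIn v j)
  ; irrefl = λ i → irrefl G (punchIn v i)
  }

-- Inserting a vertex v at the last position of a permutation turns exactly the arcs out of v
-- into descents, and inserting it at the first position exactly the arcs into v. Summing over
-- the position of v gives, for a loopless digraph D,
--   A_D(-1) = Σ_v (-1)^out(v) A_{D-v}(-1) = Σ_v (-1)^in(v) A_{D-v}(-1),
-- hence 2 A_D(-1) = Σ_v ((-1)^out(v) + (-1)^in(v)) A_{D-v}(-1), whose coefficient vanishes at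
-- every vertex of odd degree. This gives (b) at once, and (a) by induction: deleting a vertex
-- outside a union of components with an odd number of edges, or one of even degree inside it,
-- keeps that number odd. For (c) expand along the first identity. If n is odd, every
-- A_{G-u}(-1) with u ≠ v vanishes by induction, v being universal in G-u. If n is even,
-- induction gives A_{G-u}(-1) = ±A_{G-u-v}(-1), which turns the term of u into minus the term of
-- u in the expansion of (-1)^out(v) A_{G-v}(-1), so the whole sum cancels.

module Submission where

open import Algebra.Bundles using (CommutativeSemiring)
open import Data.Bool using (Bool; true; false; _∧_; _∨_; not; T)
import Data.Bool.Properties as Boolₚ
open import Data.Empty using (⊥-elim)
open import Data.Fin using (Fin; zero; suc; punchIn; punchOut; fromℕ; _<?_) renaming (_<_ to _<ᶠ_)
import Data.Fin.Properties as Finₚ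
open import Data.Integer using (ℤ; +0; +[1+_]; -[1+_]; 0ℤ; 1ℤ; -1ℤ; -_; ∣_∣) renaming (_+_ to _+ℤ_; _*_ to _*ℤ_)
import Data.Integer.Properties as ℤₚ
open import Data.Integer.Tactic.RingSolver using (solve-∀)
open import Data.List using (List; []; _∷_; _++_; map; concatMap; foldr; filter; allFin; cartesianProductWith; length)
import Data.List.Properties as Listₚ
open import Data.List.Membership.Propositional using (_∈_)
open import Data.List.Membership.Propositional.Properties
  using (∈-map⁺; ∈-map⁻; ∈-allFin; ∈-concat⁺′; ∈-filter⁺; ∈-filter⁻;
         ∈-cartesianProductWith⁺; ∈-cartesianProductWith⁻)
open import Data.List.Membership.Propositional.Properties.WithK using (unique∧set⇒bag)
open import Data.List.Relation.Binary.BagAndSetEquality using (∼bag⇒↭)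
open import Data.List.Relation.Binary.Permutation.Propositional as ↭ using (_↭_)
open import Data.List.Relation.Unary.Any using (here; there)
import Data.List.Relation.Unary.All as All
import Data.List.Relation.Unary.All.Properties as Allₚ
open import Data.List.Relation.Unary.Unique.Propositional using (Unique; []; _∷_)
import Data.List.Relation.Unary.Unique.Propositional.Properties as Uniqueₚ
open import Data.Nat using (ℕ; zero; suc; _+_; _*_; _≤_; z≤n; s≤s)
import Data.Nat.Properties as ℕₚ
open import Data.Product using (_×_; _,_; proj₁; proj₂; ∃) renaming (map to map×)
open import Data.Sum using (_⊎_; inj₁; inj₂)
open import Data.Vec using (Vec; _∷_; lookup; tabulate)
import Data.Vec.Properties as Vecₚ
open import Data.Vec.Functional using () renaming (_∷_ to _∷ᶠ_)
open import Function using (_∘_; mk⇔)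
open import Function.Definitions using (Injective)
open import Relation.Binary using (tri<; tri≈; tri>)
open import Relation.Binary.PropositionalEquality
  using (_≡_; _≢_; refl; sym; trans; cong; cong₂; subst; module ≡-Reasoning)
open import Relation.Nullary using (Dec; yes; no; does; ¬_)
open import Relation.Nullary.Decidable using (dec-true; dec-false; does-⇔; T?)

open import Defs renaming (sym to adj-sym; irrefl to adj-irrefl)

unique-sameElements⇒↭ : {A : Set} {xs ys : List A} → Unique xs → Unique ys →
                        (∀ {x} → x ∈ xs → x ∈ ys) → (∀ {x} → x ∈ ys → x ∈ xs) → xs ↭ ys
unique-sameElements⇒↭ xs! ys! to from = ∼bag⇒↭ (unique∧set⇒bag xs! ys! (mk⇔ to from))

allFin-↭-punchIn : ∀ {m} (v : Fin (suc m)) → allFin (suc m) ↭ v ∷ map (punchIn v) (allFin m)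
allFin-↭-punchIn {m} v = unique-sameElements⇒↭ (Uniqueₚ.allFin⁺ (suc m)) split! split-complete (λ {x} _ → ∈-allFin x)
  where
  v∉punchIns : ∀ {x} → x ∈ map (punchIn v) (allFin m) → v ≢ x
  v∉punchIns x∈ v≡x with ∈-map⁻ (punchIn v) x∈
  ... | i , _ , refl = Finₚ.punchInᵢ≢i v i (sym v≡x)

  split! : Unique (v ∷ map (punchIn v) (allFin m))
  split! = All.tabulate v∉punchIns ∷ Uniqueₚ.map⁺ (Finₚ.punchIn-injective v _ _) (Uniqueₚ.allFin⁺ m)

  split-complete : ∀ {x} → x ∈ allFin (suc m) → x ∈ v ∷ map (punchIn v) (allFin m)
  split-complete {x} _ with v Finₚ.≟ x
  ... | yes refl = here refl
  ... | no v≢x   = there (subst (_∈ map (punchIn v) (allFin m)) (Finₚ.punchIn-punchOut v≢x)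
                                 (∈-map⁺ (punchIn v) (∈-allFin (punchOut v≢x))))

<ᵇ-true : ∀ {n} {u w : Fin n} → u <ᶠ w → (u <ᵇ w) ≡ true
<ᵇ-true {u = u} {w} = dec-true (u <? w)

<ᵇ-false : ∀ {n} {u w : Fin n} → ¬ u <ᶠ w → (u <ᵇ w) ≡ false
<ᵇ-false {u = u} {w} = dec-false (u <? w)

<ᵇ-irrefl : ∀ {n} (u : Fin n) → (u <ᵇ u) ≡ false
<ᵇ-irrefl u = <ᵇ-false {u = u} {u} (ℕₚ.<-irrefl refl)

punchIn-<ᵇ : ∀ {n} (p : Fin (suc n)) (a b : Fin n) → (punchIn p a <ᵇ punchIn p b) ≡ (a <ᵇ b)
punchIn-<ᵇ p a b = does-⇔ (mk⇔ cancel mono) (punchIn p a <? punchIn p b) (a <? b)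
  where
  cancel : punchIn p a <ᶠ punchIn p b → a <ᶠ b
  cancel lt = ℕₚ.≰⇒> (λ b≤a → ℕₚ.<⇒≱ lt (Finₚ.punchIn-mono-≤ p b a b≤a))
  mono : a <ᶠ b → punchIn p a <ᶠ punchIn p b
  mono lt = ℕₚ.≰⇒> (λ b≤a → ℕₚ.<⇒≱ lt (Finₚ.punchIn-cancel-≤ p b a b≤a))

punchIn-exchange : ∀ {n} (v : Fin (suc (suc n))) (i : Fin (suc n)) (u≢v : punchIn v i ≢ v) (k : Fin n) →
                   punchIn (punchIn v i) (punchIn (punchOut u≢v) k) ≡ punchIn v (punchIn i k)
punchIn-exchange zero    i       u≢v k       = refl
punchIn-exchange (suc v) zero    u≢v k       = refl
punchIn-exchange (suc v) (suc i) u≢v zero    = refl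
punchIn-exchange (suc v) (suc i) u≢v (suc k) = cong suc (punchIn-exchange v i (u≢v ∘ cong suc) k)

module ListSum {c ℓ} (R : CommutativeSemiring c ℓ) where

  open CommutativeSemiring R
    renaming (_+_ to _⊕_; _*_ to _⊛_; refl to ≈-refl; sym to ≈-sym; trans to ≈-trans)
  open import Algebra.Properties.CommutativeSemigroup +-commutativeSemigroup using (interchange; x∙yz≈y∙xz)

  ∑ : {A : Set} → (A → Carrier) → List A → Carrier
  ∑ h = foldr (λ x acc → h x ⊕ acc) 0#

  ∑-cong : {A : Set} {g h : A → Carrier} → (∀ x → g x ≈ h x) → ∀ xs → ∑ g xs ≈ ∑ h xs
  ∑-cong g≈h []       = ≈-refl
  ∑-cong g≈h (x ∷ xs) = +-cong (g≈h x) (∑-cong g≈h xs)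

  ∑-zero : {A : Set} (h : A → Carrier) → (∀ x → h x ≈ 0#) → ∀ xs → ∑ h xs ≈ 0#
  ∑-zero h h≈0 []       = ≈-refl
  ∑-zero h h≈0 (x ∷ xs) = ≈-trans (+-cong (h≈0 x) (∑-zero h h≈0 xs)) (+-identityˡ 0#)

  ∑-↭ : {A : Set} (h : A → Carrier) {xs ys : List A} → xs ↭ ys → ∑ h xs ≈ ∑ h ys
  ∑-↭ h ↭.refl         = ≈-refl
  ∑-↭ h (↭.prep x p)   = +-congˡ (∑-↭ h p)
  ∑-↭ h (↭.swap x y p) = ≈-trans (x∙yz≈y∙xz (h x) (h y) _) (+-congˡ (+-congˡ (∑-↭ h p)))
  ∑-↭ h (↭.trans p q)  = ≈-trans (∑-↭ h p) (∑-↭ h q)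

  ∑-++ : {A : Set} (h : A → Carrier) (xs ys : List A) → ∑ h (xs ++ ys) ≈ ∑ h xs ⊕ ∑ h ys
  ∑-++ h []       ys = ≈-sym (+-identityˡ _)
  ∑-++ h (x ∷ xs) ys = ≈-trans (+-congˡ (∑-++ h xs ys)) (≈-sym (+-assoc (h x) _ _))

  ∑-map : {A B : Set} (h : B → Carrier) (f : A → B) (xs : List A) → ∑ h (map f xs) ≡ ∑ (h ∘ f) xs
  ∑-map h f []       = refl
  ∑-map h f (x ∷ xs) = cong (h (f x) ⊕_) (∑-map h f xs)

  ∑-+ : {A : Set} (g h : A → Carrier) (xs : List A) → ∑ (λ x → g x ⊕ h x) xs ≈ ∑ g xs ⊕ ∑ h xs
  ∑-+ g h []       = ≈-sym (+-identityˡ 0#)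
  ∑-+ g h (x ∷ xs) = ≈-trans (+-congˡ (∑-+ g h xs)) (interchange (g x) (h x) _ _)

  ∑-*ˡ : {A : Set} (a : Carrier) (h : A → Carrier) (xs : List A) → ∑ (λ x → a ⊛ h x) xs ≈ a ⊛ ∑ h xs
  ∑-*ˡ a h []       = ≈-sym (zeroʳ a)
  ∑-*ˡ a h (x ∷ xs) = ≈-trans (+-congˡ (∑-*ˡ a h xs)) (≈-sym (distribˡ a (h x) _))

  ∑-concatMap : {A B : Set} (h : B → Carrier) (f : A → List B) (xs : List A) →
                ∑ h (concatMap f xs) ≈ ∑ (∑ h ∘ f) xs
  ∑-concatMap h f []       = ≈-refl
  ∑-concatMap h f (x ∷ xs) = ≈-trans (∑-++ h (f x) _) (+-congˡ (∑-concatMap h f xs))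

  ∑-cartesianProductWith : {A B C : Set} (h : C → Carrier) (f : A → B → C) (xs : List A) (ys : List B) →
                           ∑ h (cartesianProductWith f xs ys) ≈ ∑ (λ x → ∑ (h ∘ f x) ys) xs
  ∑-cartesianProductWith h f []       ys = ≈-refl
  ∑-cartesianProductWith h f (x ∷ xs) ys =
    ≈-trans (∑-++ h (map (f x) ys) _) (+-cong (reflexive (∑-map h (f x) ys)) (∑-cartesianProductWith h f xs ys))

  ∑-allFin-punchIn : ∀ {m} (v : Fin (suc m)) (h : Fin (suc m) → Carrier) →
                     ∑ h (allFin (suc m)) ≈ h v ⊕ ∑ (h ∘ punchIn v) (allFin m)
  ∑-allFin-punchIn {m} v h =
    ≈-trans (∑-↭ h (allFin-↭-punchIn v)) (+-congˡ (reflexive (∑-map h (punchIn v) (allFin m))))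

-- Over ℤ, ∑ (sign ∘ des D) (bijections n) unfolds to A-1 D.
open ListSum ℤₚ.+-*-commutativeSemiring
open ListSum ℕₚ.+-*-commutativeSemiring using ()
  renaming (∑ to ∑ℕ; ∑-cong to ∑ℕ-cong; ∑-zero to ∑ℕ-zero; ∑-+ to ∑ℕ-+; ∑-concatMap to ∑ℕ-concatMap;
            ∑-map to ∑ℕ-map; ∑-allFin-punchIn to ∑ℕ-allFin-punchIn)

𝟙 : Bool → ℕ
𝟙 true  = 1
𝟙 false = 0

count-∑ : {A : Set} (p : A → Bool) (xs : List A) → count p xs ≡ ∑ℕ (𝟙 ∘ p) xs
count-∑ p []       = refl
count-∑ p (x ∷ xs) with p x
... | true  = cong suc (count-∑ p xs)
... | false = count-∑ p xs

count-cong : {A : Set} {p q : A → Bool} → (∀ x → p x ≡ q x) → (xs : List A) → count p xs ≡ count q xs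
count-cong {p = p} {q} p≡q xs = begin
  count p xs          ≡⟨ count-∑ p xs ⟩
  ∑ℕ (𝟙 ∘ p) xs       ≡⟨ ∑ℕ-cong (cong 𝟙 ∘ p≡q) xs ⟩
  ∑ℕ (𝟙 ∘ q) xs       ≡⟨ count-∑ q xs ⟨
  count q xs          ∎
  where open ≡-Reasoning

count-punchIn : ∀ {m} (v : Fin (suc m)) (p : Fin (suc m) → Bool) →
                count p (allFin (suc m)) ≡ 𝟙 (p v) + count (p ∘ punchIn v) (allFin m)
count-punchIn {m} v p = begin
  count p (allFin (suc m))                     ≡⟨ count-∑ p (allFin (suc m)) ⟩
  ∑ℕ (𝟙 ∘ p) (allFin (suc m))                  ≡⟨ ∑ℕ-allFin-punchIn v (𝟙 ∘ p) ⟩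
  𝟙 (p v) + ∑ℕ (𝟙 ∘ p ∘ punchIn v) (allFin m)  ≡⟨ cong (𝟙 (p v) +_) (count-∑ (p ∘ punchIn v) (allFin m)) ⟨
  𝟙 (p v) + count (p ∘ punchIn v) (allFin m)   ∎
  where open ≡-Reasoning

count-pairs : ∀ n (p : Fin n × Fin n → Bool) →
              count p (pairs n) ≡ ∑ℕ (λ u → count (λ w → p (u , w)) (allFin n)) (allFin n)
count-pairs n p = begin
  count p (pairs n)                                         ≡⟨ count-∑ p (pairs n) ⟩
  ∑ℕ (𝟙 ∘ p) (pairs n)                                      ≡⟨ ∑ℕ-concatMap (𝟙 ∘ p) row (allFin n) ⟩
  ∑ℕ (λ u → ∑ℕ (𝟙 ∘ p) (row u)) (allFin n)                  ≡⟨ ∑ℕ-cong rowCount (allFin n) ⟩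
  ∑ℕ (λ u → count (λ w → p (u , w)) (allFin n)) (allFin n)  ∎
  where
  open ≡-Reasoning
  row : Fin n → List (Fin n × Fin n)
  row u = map (u ,_) (allFin n)
  rowCount : ∀ u → ∑ℕ (𝟙 ∘ p) (row u) ≡ count (λ w → p (u , w)) (allFin n)
  rowCount u = trans (∑ℕ-map (𝟙 ∘ p) (u ,_) (allFin n)) (sym (count-∑ _ (allFin n)))

count-pairs-punchIn : ∀ {m} (v : Fin (suc m)) (p : Fin (suc m) × Fin (suc m) → Bool) →
  count p (pairs (suc m)) ≡
    𝟙 (p (v , v)) + ∑ℕ (λ k → 𝟙 (p (v , punchIn v k)) + 𝟙 (p (punchIn v k , v))) (allFin m)
                  + count (p ∘ map× (punchIn v) (punchIn v)) (pairs m)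
count-pairs-punchIn {m} v p = begin
  count p (pairs (suc m))
    ≡⟨ count-pairs (suc m) p ⟩
  ∑ℕ row (allFin (suc m))
    ≡⟨ ∑ℕ-allFin-punchIn v row ⟩
  row v + ∑ℕ (row ∘ punchIn v) (allFin m)
    ≡⟨ cong₂ _+_ rowᵥ (∑ℕ-cong rowₚ (allFin m)) ⟩
  𝟙 (p (v , v)) + ∑ℕ out (allFin m) + ∑ℕ (λ i → inn i + rest i) (allFin m)
    ≡⟨ cong (𝟙 (p (v , v)) + ∑ℕ out (allFin m) +_) (∑ℕ-+ inn rest (allFin m)) ⟩
  𝟙 (p (v , v)) + ∑ℕ out (allFin m) + (∑ℕ inn (allFin m) + ∑ℕ rest (allFin m))
    ≡⟨ regroup (𝟙 (p (v , v))) (∑ℕ out (allFin m)) (∑ℕ inn (allFin m)) (∑ℕ rest (allFin m)) ⟩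
  𝟙 (p (v , v)) + (∑ℕ out (allFin m) + ∑ℕ inn (allFin m)) + ∑ℕ rest (allFin m)
    ≡⟨ cong₂ (λ a b → 𝟙 (p (v , v)) + a + b) (∑ℕ-+ out inn (allFin m)) (count-pairs m _) ⟨
  𝟙 (p (v , v)) + ∑ℕ (λ k → out k + inn k) (allFin m) + count (p ∘ map× (punchIn v) (punchIn v)) (pairs m) ∎
  where
  open ≡-Reasoning
  row : Fin (suc m) → ℕ
  row u = count (λ w → p (u , w)) (allFin (suc m))
  out inn rest : Fin m → ℕ
  out k  = 𝟙 (p (v , punchIn v k))
  inn k  = 𝟙 (p (punchIn v k , v))
  rest i = count (λ k → p (punchIn v i , punchIn v k)) (allFin m)
  rowᵥ : row v ≡ 𝟙 (p (v , v)) + ∑ℕ out (allFin m)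
  rowᵥ = trans (count-punchIn v _) (cong (𝟙 (p (v , v)) +_) (count-∑ _ (allFin m)))
  rowₚ : ∀ i → row (punchIn v i) ≡ inn i + rest i
  rowₚ i = count-punchIn v _
  regroup : ∀ a b c d → a + b + (c + d) ≡ a + (b + c) + d
  regroup a b c d = trans (sym (ℕₚ.+-assoc (a + b) c d)) (cong (_+ d) (ℕₚ.+-assoc a b c))

count≤length : {A : Set} (p : A → Bool) (xs : List A) → count p xs ≤ length xs
count≤length p []       = z≤n
count≤length p (x ∷ xs) with p x
... | true  = s≤s (count≤length p xs)
... | false = ℕₚ.m≤n⇒m≤1+n (count≤length p xs)

count≡length⇒all : {A : Set} (p : A → Bool) (xs : List A) → count p xs ≡ length xs → ∀ {x} → x ∈ xs → p x ≡ true
count≡length⇒all p (y ∷ xs) full x∈ with p y in py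
... | false = ⊥-elim (ℕₚ.<-irrefl refl (subst (_≤ length xs) full (count≤length p xs)))
... | true with x∈
...   | here refl  = py
...   | there x∈xs = count≡length⇒all p xs (ℕₚ.suc-injective full) x∈xs

𝟙-<ᵇ-split : ∀ {n} {u w : Fin n} → u ≢ w → ∀ b → 𝟙 ((u <ᵇ w) ∧ b) + 𝟙 ((w <ᵇ u) ∧ b) ≡ 𝟙 b
𝟙-<ᵇ-split {u = u} {w} u≢w b with Finₚ.<-cmp u w
... | tri< u<w _ _ rewrite <ᵇ-true u<w | <ᵇ-false (ℕₚ.<-asym u<w) = ℕₚ.+-identityʳ (𝟙 b)
... | tri≈ _ u≡w _ = ⊥-elim (u≢w u≡w)
... | tri> _ _ w<u rewrite <ᵇ-true w<u | <ᵇ-false (ℕₚ.<-asym w<u) = refl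

sign-+ : ∀ a b → sign (a + b) ≡ sign a *ℤ sign b
sign-+ zero    b = sym (ℤₚ.*-identityˡ (sign b))
sign-+ (suc a) b = trans (cong -_ (sign-+ a b)) (ℤₚ.neg-distribˡ-* (sign a) (sign b))

sign-odd : ∀ k → Odd k → sign k ≡ -1ℤ
sign-odd (suc zero)    _   = refl
sign-odd (suc (suc k)) odd = trans (ℤₚ.neg-involutive (sign k)) (sign-odd k odd)

sign-even : ∀ k → Even k → sign k ≡ 1ℤ
sign-even zero          _    = refl
sign-even (suc (suc k)) even = trans (ℤₚ.neg-involutive (sign k)) (sign-even k even)

parity : ∀ k → Even k ⊎ Odd k
parity zero          = inj₁ refl
parity (suc zero)    = inj₂ refl
parity (suc (suc k)) = parity k

odd-suc⇒even : ∀ k → Odd (suc k) → Even k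
odd-suc⇒even zero          _   = refl
odd-suc⇒even (suc (suc k)) odd = odd-suc⇒even k odd

odd⇒even-suc : ∀ k → Odd k → Even (suc k)
odd⇒even-suc (suc zero)    _   = refl
odd⇒even-suc (suc (suc k)) odd = odd⇒even-suc k odd

even⇒odd-suc : ∀ k → Even k → Odd (suc k)
even⇒odd-suc zero          _    = refl
even⇒odd-suc (suc (suc k)) even = even⇒odd-suc k even

even+odd⇒odd : ∀ a b → Even a → Odd (a + b) → Odd b
even+odd⇒odd zero          b _    odd = odd
even+odd⇒odd (suc (suc a)) b even odd = even+odd⇒odd a b even odd

sign+sign≡0 : ∀ a b → Odd (a + b) → sign a +ℤ sign b ≡ 0ℤ
sign+sign≡0 zero          b odd = cong (1ℤ +ℤ_) (sign-odd b odd)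
sign+sign≡0 (suc zero)    b odd = cong (-1ℤ +ℤ_) (sign-even b (odd-suc⇒even b odd))
sign+sign≡0 (suc (suc a)) b odd = trans (cong (_+ℤ sign b) (ℤₚ.neg-involutive (sign a))) (sign+sign≡0 a b odd)

sign-exchange : ∀ a b x y (z : ℤ) → a + b ≡ 1 →
                sign (a + x) *ℤ (sign y *ℤ z) ≡ - (sign (b + y) *ℤ (sign x *ℤ z))
sign-exchange zero       (suc zero) x y z _ = lemma (sign x) (sign y) z
  where
  lemma : ∀ p q r → p *ℤ (q *ℤ r) ≡ - ((- q) *ℤ (p *ℤ r))
  lemma = solve-∀
sign-exchange (suc zero) zero       x y z _ = lemma (sign x) (sign y) z
  where
  lemma : ∀ p q r → (- p) *ℤ (q *ℤ r) ≡ - (q *ℤ (p *ℤ r))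
  lemma = solve-∀

∣sign∣≡1 : ∀ k → ∣ sign k ∣ ≡ 1
∣sign∣≡1 zero    = refl
∣sign∣≡1 (suc k) = trans (ℤₚ.∣-i∣≡∣i∣ (sign k)) (∣sign∣≡1 k)

∣sign*x∣≡∣x∣ : ∀ k x → ∣ sign k *ℤ x ∣ ≡ ∣ x ∣
∣sign*x∣≡∣x∣ k x =
  trans (ℤₚ.abs-* (sign k) x) (trans (cong (_* ∣ x ∣) (∣sign∣≡1 k)) (ℕₚ.*-identityˡ ∣ x ∣))

x+x≡0⇒x≡0 : ∀ (x : ℤ) → x +ℤ x ≡ 0ℤ → x ≡ 0ℤ
x+x≡0⇒x≡0 +0        _  = refl
x+x≡0⇒x≡0 +[1+ n ]  ()
x+x≡0⇒x≡0 -[1+ n ]  ()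

pairs-complete : ∀ n (u w : Fin n) → (u , w) ∈ pairs n
pairs-complete n u w = ∈-concat⁺′ (∈-map⁺ (u ,_) (∈-allFin w)) (∈-map⁺ (λ u → map (u ,_) (allFin n)) (∈-allFin u))

T-≟⇒implies : ∀ {n} (i j a b : Fin n) → T (does (i Finₚ.≟ j) ∨ not (does (a Finₚ.≟ b))) → a ≡ b → i ≡ j
T-≟⇒implies i j a b t a≡b with i Finₚ.≟ j | a Finₚ.≟ b
... | yes i≡j | _       = i≡j
... | no _    | no a≢b  = ⊥-elim (a≢b a≡b)

implies⇒T-≟ : ∀ {n} (i j a b : Fin n) → (a ≡ b → i ≡ j) → T (does (i Finₚ.≟ j) ∨ not (does (a Finₚ.≟ b)))
implies⇒T-≟ i j a b imp with i Finₚ.≟ j | a Finₚ.≟ b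
... | yes _   | _       = _
... | no _    | no _    = _
... | no i≢j  | yes a≡b = i≢j (imp a≡b)

isInjective⇒Injective : ∀ {n} (f : Fin n → Fin n) → T (isInjective f) → Injective _≡_ _≡_ f
isInjective⇒Injective {n} f inj {i} {j} =
  T-≟⇒implies i j (f i) (f j) (All.lookup (Allₚ.all⁺ _ (pairs n) inj) (pairs-complete n i j))

Injective⇒isInjective : ∀ {n} (f : Fin n → Fin n) → Injective _≡_ _≡_ f → T (isInjective f)
Injective⇒isInjective {n} f inj = Allₚ.all⁻ _ {pairs n} (All.tabulate λ { {i , j} _ → implies⇒T-≟ i j (f i) (f j) inj })

map-filter : {A B : Set} (f : A → B) {P : B → Set} (P? : ∀ y → Dec (P y)) (xs : List A) →
             map f (filter (P? ∘ f) xs) ≡ filter P? (map f xs)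
map-filter f P? []       = refl
map-filter f P? (x ∷ xs) with does (P? (f x))
... | true  = cong (f x ∷_) (map-filter f P? xs)
... | false = map-filter f P? xs

-- Functions Fin n → Fin m are compared through their tabulations, since equality of functions
-- is not extensional.
vectors : (n m : ℕ) → List (Vec (Fin m) n)
vectors n m = map tabulate (allFuns n m)

vectors-suc : ∀ n m → vectors (suc n) m ≡ cartesianProductWith (λ v i → i ∷ v) (vectors n m) (allFin m)
vectors-suc n m = go (allFuns n m)
  where
  go : ∀ fs → map tabulate (concatMap (λ f → map (_∷ᶠ f) (allFin m)) fs)
              ≡ cartesianProductWith (λ v i → i ∷ v) (map tabulate fs) (allFin m)
  go []       = refl
  go (f ∷ fs) = trans (Listₚ.map-++ tabulate (map (_∷ᶠ f) (allFin m)) _)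
                      (cong₂ _++_ (sym (Listₚ.map-∘ (allFin m))) (go fs))

vectors-unique : ∀ n m → Unique (vectors n m)
vectors-unique zero    m = All.[] ∷ []
vectors-unique (suc n) m = subst Unique (sym (vectors-suc n m))
  (Uniqueₚ.cartesianProductWith⁺ (λ v i → i ∷ v) (λ eq → let i≡j , v≡w = Vecₚ.∷-injective eq in v≡w , i≡j)
                                 (vectors-unique n m) (Uniqueₚ.allFin⁺ m))

∈-vectors : ∀ {n m} (v : Vec (Fin m) n) → v ∈ vectors n m
∈-vectors Data.Vec.[] = here refl
∈-vectors {suc n} {m} (i ∷ v) = subst ((i ∷ v) ∈_) (sym (vectors-suc n m))
  (∈-cartesianProductWith⁺ (λ v i → i ∷ v) (∈-vectors v) (∈-allFin i))

permutationVecs : (n : ℕ) → List (Vec (Fin n) n)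
permutationVecs n = map tabulate (bijections n)

permutationVecs≡filter : ∀ n → permutationVecs n ≡ filter (T? ∘ isInjective ∘ lookup) (vectors n n)
permutationVecs≡filter n =
  trans (cong (map tabulate) (Listₚ.filter-≐ (T? ∘ isInjective {n}) (T? ∘ isInjective {n} ∘ lookup ∘ tabulate)
                                             (to , from) (allFuns n n)))
        (map-filter tabulate (T? ∘ isInjective ∘ lookup) (allFuns n n))
  where
  to : ∀ {f : Fin n → Fin n} → T (isInjective f) → T (isInjective (lookup (tabulate f)))
  to {f} t = Injective⇒isInjective (lookup (tabulate f)) λ {i} {j} eq →
    isInjective⇒Injective f t (trans (sym (Vecₚ.lookup∘tabulate f i)) (trans eq (Vecₚ.lookup∘tabulate f j)))
  from : ∀ {f : Fin n → Fin n} → T (isInjective (lookup (tabulate f))) → T (isInjective f)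
  from {f} t = Injective⇒isInjective f λ {i} {j} eq →
    isInjective⇒Injective (lookup (tabulate f)) t
      (trans (Vecₚ.lookup∘tabulate f i) (trans eq (sym (Vecₚ.lookup∘tabulate f j))))

permutationVecs-unique : ∀ n → Unique (permutationVecs n)
permutationVecs-unique n =
  subst Unique (sym (permutationVecs≡filter n)) (Uniqueₚ.filter⁺ _ (vectors-unique n n))

∈-permutationVecs⁻ : ∀ {n} {v : Vec (Fin n) n} → v ∈ permutationVecs n → Injective _≡_ _≡_ (lookup v)
∈-permutationVecs⁻ {n} {v} v∈ = isInjective⇒Injective (lookup v)
  (proj₂ (∈-filter⁻ (T? ∘ isInjective ∘ lookup) {xs = vectors n n} (subst (v ∈_) (permutationVecs≡filter n) v∈)))

∈-permutationVecs⁺ : ∀ {n} {v : Vec (Fin n) n} → Injective _≡_ _≡_ (lookup v) → v ∈ permutationVecs n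
∈-permutationVecs⁺ {n} {v} inj = subst (v ∈_) (sym (permutationVecs≡filter n))
  (∈-filter⁺ (T? ∘ isInjective ∘ lookup) (∈-vectors v) (Injective⇒isInjective (lookup v) inj))

injective⇒surjective : ∀ {n} (σ : Fin n → Fin n) → Injective _≡_ _≡_ σ → ∀ j → ∃ λ v → σ v ≡ j
injective⇒surjective {suc m} σ inj j with Finₚ.any? (λ v → σ v Finₚ.≟ j)
... | yes hit = hit
... | no miss = ⊥-elim (collision (Finₚ.pigeonhole (ℕₚ.n<1+n m) (λ x → punchOut (j≢σ x))))
  where
  j≢σ : ∀ x → j ≢ σ x
  j≢σ x j≡σx = miss (x , sym j≡σx)
  collision : ¬ (∃ λ a → ∃ λ b → a <ᶠ b × punchOut (j≢σ a) ≡ punchOut (j≢σ b))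
  collision (a , b , a<b , eq) = Finₚ.<⇒≢ a<b (inj (Finₚ.punchOut-injective (j≢σ a) (j≢σ b) eq))

insert : ∀ {m} (j v : Fin (suc m)) → (Fin m → Fin m) → Fin (suc m) → Fin (suc m)
insert j v τ x with v Finₚ.≟ x
... | yes _   = j
... | no v≢x = punchIn j (τ (punchOut v≢x))

module _ {m} (j v : Fin (suc m)) (τ : Fin m → Fin m) where

  insert-at : insert j v τ v ≡ j
  insert-at with v Finₚ.≟ v
  ... | yes _  = refl
  ... | no v≢v = ⊥-elim (v≢v refl)

  insert-punchIn : ∀ i → insert j v τ (punchIn v i) ≡ punchIn j (τ i)
  insert-punchIn i with v Finₚ.≟ punchIn v i
  ... | yes v≡ = ⊥-elim (Finₚ.punchInᵢ≢i v i (sym v≡))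
  ... | no v≢  = cong (punchIn j ∘ τ) (Finₚ.punchOut-punchIn v)

  insert-injective : Injective _≡_ _≡_ τ → Injective _≡_ _≡_ (insert j v τ)
  insert-injective inj {x} {y} eq with v Finₚ.≟ x | v Finₚ.≟ y
  ... | yes v≡x | yes v≡y = trans (sym v≡x) v≡y
  ... | yes _   | no _    = ⊥-elim (Finₚ.punchInᵢ≢i j _ (sym eq))
  ... | no _    | yes _   = ⊥-elim (Finₚ.punchInᵢ≢i j _ eq)
  ... | no v≢x  | no v≢y  = Finₚ.punchOut-injective v≢x v≢y (inj (Finₚ.punchIn-injective j _ _ eq))

insert-cancel : ∀ {m} (j : Fin (suc m)) {v v′ : Fin (suc m)} {τ τ′ : Fin m → Fin m} →
                (∀ x → insert j v τ x ≡ insert j v′ τ′ x) → v ≡ v′ × (∀ i → τ i ≡ τ′ i)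
insert-cancel j {v} {v′} {τ} {τ′} same = v≡v′ , τ≗τ′
  where
  v≡v′ : v ≡ v′
  v≡v′ with v′ Finₚ.≟ v
  ... | yes v′≡v = sym v′≡v
  ... | no v′≢v  = ⊥-elim (Finₚ.punchInᵢ≢i j _ (sym (begin
    j                                           ≡⟨ insert-at j v τ ⟨
    insert j v τ v                              ≡⟨ same v ⟩
    insert j v′ τ′ v                            ≡⟨ cong (insert j v′ τ′) (Finₚ.punchIn-punchOut v′≢v) ⟨
    insert j v′ τ′ (punchIn v′ (punchOut v′≢v)) ≡⟨ insert-punchIn j v′ τ′ _ ⟩
    punchIn j (τ′ (punchOut v′≢v))              ∎)))
    where open ≡-Reasoning
  τ≗τ′ : ∀ i → τ i ≡ τ′ i
  τ≗τ′ i = Finₚ.punchIn-injective j _ _ (begin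
    punchIn j (τ i)               ≡⟨ insert-punchIn j v τ i ⟨
    insert j v τ (punchIn v i)    ≡⟨ same (punchIn v i) ⟩
    insert j v′ τ′ (punchIn v i)  ≡⟨ cong (λ w → insert j v′ τ′ (punchIn w i)) v≡v′ ⟩
    insert j v′ τ′ (punchIn v′ i) ≡⟨ insert-punchIn j v′ τ′ i ⟩
    punchIn j (τ′ i)              ∎)
    where open ≡-Reasoning

insert-cong : ∀ {m} (j v : Fin (suc m)) {τ τ′ : Fin m → Fin m} → (∀ i → τ i ≡ τ′ i) →
              ∀ x → insert j v τ x ≡ insert j v τ′ x
insert-cong j v τ≗τ′ x with v Finₚ.≟ x
... | yes _   = refl
... | no v≢x = cong (punchIn j) (τ≗τ′ (punchOut v≢x))

injective⇒insert : ∀ {m} (σ : Fin (suc m) → Fin (suc m)) → Injective _≡_ _≡_ σ → ∀ {v j} → σ v ≡ j →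
                   ∃ λ τ → Injective _≡_ _≡_ τ × (∀ x → σ x ≡ insert j v τ x)
injective⇒insert {m} σ inj {v} {j} σv≡j = τ , τ-injective , σ≗insert
  where
  j≢σ : ∀ i → j ≢ σ (punchIn v i)
  j≢σ i j≡σ = Finₚ.punchInᵢ≢i v i (inj (trans (sym j≡σ) (sym σv≡j)))
  τ : Fin m → Fin m
  τ i = punchOut (j≢σ i)
  τ-injective : Injective _≡_ _≡_ τ
  τ-injective eq = Finₚ.punchIn-injective v _ _ (inj (Finₚ.punchOut-injective (j≢σ _) (j≢σ _) eq))
  σ≗insert : ∀ x → σ x ≡ insert j v τ x
  σ≗insert x with v Finₚ.≟ x
  ... | yes refl = σv≡j
  ... | no v≢x   = sym (trans (Finₚ.punchIn-punchOut (j≢σ (punchOut v≢x))) (cong σ (Finₚ.punchIn-punchOut v≢x)))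

insertVec : ∀ {m} (j v : Fin (suc m)) → Vec (Fin m) m → Vec (Fin (suc m)) (suc m)
insertVec j v τ = tabulate (insert j v (lookup τ))

permutationVecs-↭-insertVec : ∀ {m} (j : Fin (suc m)) →
  permutationVecs (suc m) ↭ cartesianProductWith (insertVec j) (allFin (suc m)) (permutationVecs m)
permutationVecs-↭-insertVec {m} j =
  unique-sameElements⇒↭ (permutationVecs-unique (suc m)) insertions-unique decompose compose
  where
  lookup-insertVec : ∀ v τ x → lookup (insertVec j v τ) x ≡ insert j v (lookup τ) x
  lookup-insertVec v τ = Vecₚ.lookup∘tabulate (insert j v (lookup τ))

  insertVec-cancel : ∀ {v v′ τ τ′} → insertVec j v τ ≡ insertVec j v′ τ′ → v ≡ v′ × τ ≡ τ′
  insertVec-cancel {v} {v′} {τ} {τ′} eq =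
    let v≡v′ , τ≗τ′ = insert-cancel j λ x →
          trans (sym (lookup-insertVec v τ x)) (trans (cong (λ σ → lookup σ x) eq) (lookup-insertVec v′ τ′ x))
    in v≡v′ , trans (sym (Vecₚ.tabulate∘lookup τ)) (trans (Vecₚ.tabulate-cong τ≗τ′) (Vecₚ.tabulate∘lookup τ′))

  insertions-unique : Unique (cartesianProductWith (insertVec j) (allFin (suc m)) (permutationVecs m))
  insertions-unique = Uniqueₚ.cartesianProductWith⁺ (insertVec j) insertVec-cancel
                                                     (Uniqueₚ.allFin⁺ (suc m)) (permutationVecs-unique m)

  compose : ∀ {σ} → σ ∈ cartesianProductWith (insertVec j) (allFin (suc m)) (permutationVecs m) →
            σ ∈ permutationVecs (suc m)
  compose σ∈ with ∈-cartesianProductWith⁻ (insertVec j) (allFin (suc m)) (permutationVecs m) σ∈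
  ... | v , τ , _ , τ∈ , refl = ∈-permutationVecs⁺ λ {x} {y} eq →
    insert-injective j v (lookup τ) (∈-permutationVecs⁻ τ∈)
      (trans (sym (lookup-insertVec v τ x)) (trans eq (lookup-insertVec v τ y)))

  decompose : ∀ {σ} → σ ∈ permutationVecs (suc m) →
              σ ∈ cartesianProductWith (insertVec j) (allFin (suc m)) (permutationVecs m)
  decompose {σ} σ∈ = subst (_∈ cartesianProductWith (insertVec j) (allFin (suc m)) (permutationVecs m)) σ≡
    (∈-cartesianProductWith⁺ (insertVec j) (∈-allFin v) (∈-permutationVecs⁺ {v = tabulate τ} τ-injective′))
    where
    σ-injective : Injective _≡_ _≡_ (lookup σ)
    σ-injective = ∈-permutationVecs⁻ σ∈
    v : Fin (suc m)
    v = proj₁ (injective⇒surjective (lookup σ) σ-injective j)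
    decomposition : ∃ λ τ → Injective _≡_ _≡_ τ × (∀ x → lookup σ x ≡ insert j v τ x)
    decomposition = injective⇒insert (lookup σ) σ-injective (proj₂ (injective⇒surjective (lookup σ) σ-injective j))
    τ : Fin m → Fin m
    τ = proj₁ decomposition
    τ-injective′ : Injective _≡_ _≡_ (lookup (tabulate τ))
    τ-injective′ {a} {b} eq = proj₁ (proj₂ decomposition)
      (trans (sym (Vecₚ.lookup∘tabulate τ a)) (trans eq (Vecₚ.lookup∘tabulate τ b)))
    σ≡ : insertVec j v (tabulate τ) ≡ σ
    σ≡ = trans (Vecₚ.tabulate-cong λ x → trans (insert-cong j v (Vecₚ.lookup∘tabulate τ) x)
                                               (sym (proj₂ (proj₂ decomposition) x)))
               (Vecₚ.tabulate∘lookup σ)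

-- Recurrences for A_D(-1)
deleteᴰ : ∀ {m} → Digraph (suc m) → Fin (suc m) → Digraph m
deleteᴰ D v i k = D (punchIn v i) (punchIn v k)

des-cong : ∀ {n} (D : Digraph n) {σ σ′ : Fin n → Fin n} → (∀ x → σ x ≡ σ′ x) → des D σ ≡ des D σ′
des-cong {n} D σ≗σ′ =
  count-cong (λ { (u , w) → cong₂ (λ a b → D u w ∧ (a <ᵇ b)) (σ≗σ′ w) (σ≗σ′ u) }) (pairs n)

A-1-cong : ∀ {n} {D E : Digraph n} → (∀ u w → D u w ≡ E u w) → A-1 D ≡ A-1 E
A-1-cong {n} D≗E =
  ∑-cong (λ σ → cong sign (count-cong (λ { (u , w) → cong (_∧ (σ w <ᵇ σ u)) (D≗E u w) }) (pairs n))) (bijections n)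

A-1-permutationVecs : ∀ {n} (D : Digraph n) → A-1 D ≡ ∑ (λ σ → sign (des D (lookup σ))) (permutationVecs n)
A-1-permutationVecs {n} D = sym (trans (∑-map (λ σ → sign (des D (lookup σ))) tabulate (bijections n))
  (∑-cong (λ σ → cong sign (des-cong D (Vecₚ.lookup∘tabulate σ))) (bijections n)))

A-1-insert : ∀ {m} (D : Digraph (suc m)) (j : Fin (suc m)) →
  A-1 D ≡ ∑ (λ v → ∑ (λ τ → sign (des D (insert j v (lookup τ)))) (permutationVecs m)) (allFin (suc m))
A-1-insert {m} D j = begin
  A-1 D
    ≡⟨ A-1-permutationVecs D ⟩
  ∑ signDes (permutationVecs (suc m))
    ≡⟨ ∑-↭ signDes (permutationVecs-↭-insertVec j) ⟩
  ∑ signDes (cartesianProductWith (insertVec j) (allFin (suc m)) (permutationVecs m))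
    ≡⟨ ∑-cartesianProductWith signDes (insertVec j) (allFin (suc m)) (permutationVecs m) ⟩
  ∑ (λ v → ∑ (signDes ∘ insertVec j v) (permutationVecs m)) (allFin (suc m))
    ≡⟨ ∑-cong (λ v → ∑-cong (λ τ → cong sign (des-cong D (Vecₚ.lookup∘tabulate (insert j v (lookup τ)))))
                            (permutationVecs m)) (allFin (suc m)) ⟩
  ∑ (λ v → ∑ (λ τ → sign (des D (insert j v (lookup τ)))) (permutationVecs m)) (allFin (suc m)) ∎
  where
  open ≡-Reasoning
  signDes : Vec (Fin (suc m)) (suc m) → ℤ
  signDes σ = sign (des D (lookup σ))

A-1-recurrence : ∀ {m} (D : Digraph (suc m)) (j : Fin (suc m)) (c : Fin (suc m) → ℕ) →
                 (∀ v τ → des D (insert j v τ) ≡ c v + des (deleteᴰ D v) τ) →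
                 A-1 D ≡ ∑ (λ v → sign (c v) *ℤ A-1 (deleteᴰ D v)) (allFin (suc m))
A-1-recurrence {m} D j c des-insert = trans (A-1-insert D j) (∑-cong row (allFin (suc m)))
  where
  row : ∀ v → ∑ (λ τ → sign (des D (insert j v (lookup τ)))) (permutationVecs m) ≡ sign (c v) *ℤ A-1 (deleteᴰ D v)
  row v = begin
    ∑ (λ τ → sign (des D (insert j v (lookup τ)))) (permutationVecs m)
      ≡⟨ ∑-cong (λ τ → trans (cong sign (des-insert v (lookup τ))) (sign-+ (c v) _)) (permutationVecs m) ⟩
    ∑ (λ τ → sign (c v) *ℤ sign (des (deleteᴰ D v) (lookup τ))) (permutationVecs m)
      ≡⟨ ∑-*ˡ (sign (c v)) _ (permutationVecs m) ⟩
    sign (c v) *ℤ ∑ (λ τ → sign (des (deleteᴰ D v) (lookup τ))) (permutationVecs m)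
      ≡⟨ cong (sign (c v) *ℤ_) (A-1-permutationVecs (deleteᴰ D v)) ⟨
    sign (c v) *ℤ A-1 (deleteᴰ D v) ∎
    where open ≡-Reasoning

des-insert : ∀ {m} (D : Digraph (suc m)) (j v : Fin (suc m)) (τ : Fin m → Fin m) →
  des D (insert j v τ) ≡
    ∑ℕ (λ k → 𝟙 (D v (punchIn v k) ∧ (punchIn j (τ k) <ᵇ j)) + 𝟙 (D (punchIn v k) v ∧ (j <ᵇ punchIn j (τ k))))
       (allFin m)
    + des (deleteᴰ D v) τ
des-insert {m} D j v τ = trans (count-pairs-punchIn v _) (cong₂ _+_ (cong₂ _+_ noLoop arcsAtV) arcsAwayFromV)
  where
  σ : Fin (suc m) → Fin (suc m)
  σ = insert j v τ
  noLoop : 𝟙 (D v v ∧ (σ v <ᵇ σ v)) ≡ 0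
  noLoop = cong 𝟙 (trans (cong (D v v ∧_) (<ᵇ-irrefl (σ v))) (Boolₚ.∧-zeroʳ (D v v)))
  arcsAtV : ∑ℕ (λ k → 𝟙 (D v (punchIn v k) ∧ (σ (punchIn v k) <ᵇ σ v))
                       + 𝟙 (D (punchIn v k) v ∧ (σ v <ᵇ σ (punchIn v k)))) (allFin m)
          ≡ ∑ℕ (λ k → 𝟙 (D v (punchIn v k) ∧ (punchIn j (τ k) <ᵇ j))
                       + 𝟙 (D (punchIn v k) v ∧ (j <ᵇ punchIn j (τ k)))) (allFin m)
  arcsAtV = ∑ℕ-cong (λ k → cong₂ (λ a b → 𝟙 (D v (punchIn v k) ∧ (a <ᵇ b)) + 𝟙 (D (punchIn v k) v ∧ (b <ᵇ a)))
                                 (insert-punchIn j v τ k) (insert-at j v τ)) (allFin m)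
  arcsAwayFromV : count (λ ik → deleteᴰ D v (proj₁ ik) (proj₂ ik)
                                ∧ (σ (punchIn v (proj₂ ik)) <ᵇ σ (punchIn v (proj₁ ik)))) (pairs m)
                ≡ des (deleteᴰ D v) τ
  arcsAwayFromV = count-cong (λ { (i , k) → cong (deleteᴰ D v i k ∧_)
    (trans (cong₂ _<ᵇ_ (insert-punchIn j v τ k) (insert-punchIn j v τ i)) (punchIn-<ᵇ j (τ k) (τ i))) }) (pairs m)

Loopless : ∀ {n} → Digraph n → Set
Loopless D = ∀ v → D v v ≡ false

outdeg indeg : ∀ {n} → Digraph n → Fin n → ℕ
outdeg {n} D v = count (D v) (allFin n)
indeg  {n} D v = count (λ u → D u v) (allFin n)

module _ {m} (D : Digraph (suc m)) (loopless : Loopless D) where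

  outdeg-punchIn : ∀ v → outdeg D v ≡ ∑ℕ (λ k → 𝟙 (D v (punchIn v k))) (allFin m)
  outdeg-punchIn v = trans (count-punchIn v (D v)) (cong₂ _+_ (cong 𝟙 (loopless v)) (count-∑ _ (allFin m)))

  indeg-punchIn : ∀ v → indeg D v ≡ ∑ℕ (λ k → 𝟙 (D (punchIn v k) v)) (allFin m)
  indeg-punchIn v = trans (count-punchIn v (λ u → D u v)) (cong₂ _+_ (cong 𝟙 (loopless v)) (count-∑ _ (allFin m)))

  des-insert-top : ∀ v τ → des D (insert (fromℕ m) v τ) ≡ outdeg D v + des (deleteᴰ D v) τ
  des-insert-top v τ = trans (des-insert D (fromℕ m) v τ)
    (cong (_+ des (deleteᴰ D v) τ) (trans (∑ℕ-cong onlyOut (allFin m)) (sym (outdeg-punchIn v))))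
    where
    below : ∀ x → punchIn (fromℕ m) x <ᶠ fromℕ m
    below x = Finₚ.≤∧≢⇒< (Finₚ.≤fromℕ _) (Finₚ.punchInᵢ≢i (fromℕ m) x)
    onlyOut : ∀ k → 𝟙 (D v (punchIn v k) ∧ (punchIn (fromℕ m) (τ k) <ᵇ fromℕ m))
                    + 𝟙 (D (punchIn v k) v ∧ (fromℕ m <ᵇ punchIn (fromℕ m) (τ k)))
                  ≡ 𝟙 (D v (punchIn v k))
    onlyOut k rewrite <ᵇ-true (below (τ k)) | <ᵇ-false (ℕₚ.<-asym (below (τ k)))
                    | Boolₚ.∧-identityʳ (D v (punchIn v k)) | Boolₚ.∧-zeroʳ (D (punchIn v k) v)
                    = ℕₚ.+-identityʳ _

  des-insert-bottom : ∀ v τ → des D (insert zero v τ) ≡ indeg D v + des (deleteᴰ D v) τ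
  des-insert-bottom v τ = trans (des-insert D zero v τ)
    (cong (_+ des (deleteᴰ D v) τ) (trans (∑ℕ-cong onlyIn (allFin m)) (sym (indeg-punchIn v))))
    where
    onlyIn : ∀ k → 𝟙 (D v (punchIn v k) ∧ (punchIn zero (τ k) <ᵇ zero))
                   + 𝟙 (D (punchIn v k) v ∧ (zero <ᵇ punchIn zero (τ k)))
                 ≡ 𝟙 (D (punchIn v k) v)
    onlyIn k rewrite <ᵇ-false {u = suc (τ k)} {zero} (λ ()) | <ᵇ-true {u = zero} {suc (τ k)} (s≤s z≤n)
                   | Boolₚ.∧-zeroʳ (D v (punchIn v k)) | Boolₚ.∧-identityʳ (D (punchIn v k) v)
                   = refl

  A-1-top : A-1 D ≡ ∑ (λ v → sign (outdeg D v) *ℤ A-1 (deleteᴰ D v)) (allFin (suc m))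
  A-1-top = A-1-recurrence D (fromℕ m) (outdeg D) des-insert-top

  A-1-bottom : A-1 D ≡ ∑ (λ v → sign (indeg D v) *ℤ A-1 (deleteᴰ D v)) (allFin (suc m))
  A-1-bottom = A-1-recurrence D zero (indeg D) des-insert-bottom

  A-1-double : A-1 D +ℤ A-1 D ≡
               ∑ (λ v → (sign (outdeg D v) +ℤ sign (indeg D v)) *ℤ A-1 (deleteᴰ D v)) (allFin (suc m))
  A-1-double = trans (cong₂ _+ℤ_ A-1-top A-1-bottom)
    (trans (sym (∑-+ (λ v → sign (outdeg D v) *ℤ A-1 (deleteᴰ D v)) (λ v → sign (indeg D v) *ℤ A-1 (deleteᴰ D v))
                     (allFin (suc m))))
           (∑-cong (λ v → sym (ℤₚ.*-distribʳ-+ (A-1 (deleteᴰ D v)) (sign (outdeg D v)) (sign (indeg D v))))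
                   (allFin (suc m))))

A-1≡0 : ∀ {m} (D : Digraph (suc m)) → Loopless D →
        (∀ v → Odd (outdeg D v + indeg D v) ⊎ A-1 (deleteᴰ D v) ≡ 0ℤ) → A-1 D ≡ 0ℤ
A-1≡0 {m} D loopless each = x+x≡0⇒x≡0 (A-1 D) (trans (A-1-double D loopless) (∑-zero _ term (allFin (suc m))))
  where
  term : ∀ v → (sign (outdeg D v) +ℤ sign (indeg D v)) *ℤ A-1 (deleteᴰ D v) ≡ 0ℤ
  term v with each v
  ... | inj₁ odd = trans (cong (_*ℤ A-1 (deleteᴰ D v)) (sign+sign≡0 (outdeg D v) (indeg D v) odd))
                         (ℤₚ.*-zeroˡ (A-1 (deleteᴰ D v)))
  ... | inj₂ A≡0 = trans (cong ((sign (outdeg D v) +ℤ sign (indeg D v)) *ℤ_) A≡0)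
                         (ℤₚ.*-zeroʳ (sign (outdeg D v) +ℤ sign (indeg D v)))

-- Odd degrees and odd components
orient-loopless : ∀ {n} (G : Graph n) → Loopless (orient G)
orient-loopless G v = cong (_∧ (v <ᵇ v)) (adj-irrefl G v)

A-1-delete : ∀ {m} (G : Graph (suc m)) v → A-1 (deleteᴰ (orient G) v) ≡ A-1 (orient (delete G v))
A-1-delete G v = A-1-cong λ i k → cong (adj G (punchIn v i) (punchIn v k) ∧_) (punchIn-<ᵇ v i k)

orient-arcs : ∀ {n} (G : Graph n) {u w} → u ≢ w → 𝟙 (orient G u w) + 𝟙 (orient G w u) ≡ 𝟙 (adj G u w)
orient-arcs G {u} {w} u≢w = begin
  𝟙 (adj G u w ∧ (u <ᵇ w)) + 𝟙 (adj G w u ∧ (w <ᵇ u))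
    ≡⟨ cong₂ (λ a b → 𝟙 a + 𝟙 b) (Boolₚ.∧-comm (adj G u w) (u <ᵇ w))
             (trans (cong (_∧ (w <ᵇ u)) (adj-sym G w u)) (Boolₚ.∧-comm (adj G u w) (w <ᵇ u))) ⟩
  𝟙 ((u <ᵇ w) ∧ adj G u w) + 𝟙 ((w <ᵇ u) ∧ adj G u w)
    ≡⟨ 𝟙-<ᵇ-split u≢w (adj G u w) ⟩
  𝟙 (adj G u w) ∎
  where open ≡-Reasoning

deg-punchIn : ∀ {m} (G : Graph (suc m)) v → deg G v ≡ ∑ℕ (λ k → 𝟙 (adj G v (punchIn v k))) (allFin m)
deg-punchIn G = outdeg-punchIn (adj G) (adj-irrefl G)

outdeg+indeg≡deg : ∀ {m} (G : Graph (suc m)) v → outdeg (orient G) v + indeg (orient G) v ≡ deg G v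
outdeg+indeg≡deg {m} G v = begin
  outdeg (orient G) v + indeg (orient G) v
    ≡⟨ cong₂ _+_ (outdeg-punchIn (orient G) (orient-loopless G) v) (indeg-punchIn (orient G) (orient-loopless G) v) ⟩
  ∑ℕ (λ k → 𝟙 (orient G v (punchIn v k))) (allFin m) + ∑ℕ (λ k → 𝟙 (orient G (punchIn v k) v)) (allFin m)
    ≡⟨ ∑ℕ-+ (λ k → 𝟙 (orient G v (punchIn v k))) (λ k → 𝟙 (orient G (punchIn v k) v)) (allFin m) ⟨
  ∑ℕ (λ k → 𝟙 (orient G v (punchIn v k)) + 𝟙 (orient G (punchIn v k) v)) (allFin m)
    ≡⟨ ∑ℕ-cong (λ k → orient-arcs G (Finₚ.punchInᵢ≢i v k ∘ sym)) (allFin m) ⟩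
  ∑ℕ (λ k → 𝟙 (adj G v (punchIn v k))) (allFin m)
    ≡⟨ deg-punchIn G v ⟨
  deg G v ∎
  where open ≡-Reasoning

ν≡0-oddDegrees : ∀ m (G : Graph (suc m)) → (∀ v → Odd (deg G v)) → ν G ≡ 0
ν≡0-oddDegrees m G odd = cong ∣_∣ (A-1≡0 (orient G) (orient-loopless G) λ v →
  inj₁ (subst Odd (sym (outdeg+indeg≡deg G v)) (odd v)))

Closed : ∀ {n} → Graph n → (Fin n → Bool) → Set
Closed G C = ∀ u w → C u ≡ true → adj G u w ≡ true → C w ≡ true

Closed-delete : ∀ {m} (G : Graph (suc m)) {C} → Closed G C → ∀ v → Closed (delete G v) (C ∘ punchIn v)
Closed-delete G closed v i k = closed (punchIn v i) (punchIn v k)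

edgesIn-delete : ∀ {m} (G : Graph (suc m)) C v →
  edgesIn G C ≡ ∑ℕ (λ k → 𝟙 (adj G v (punchIn v k) ∧ C v ∧ C (punchIn v k))) (allFin m)
                + edgesIn (delete G v) (C ∘ punchIn v)
edgesIn-delete {m} G C v = trans (count-pairs-punchIn v inside) (cong₂ _+_ (cong₂ _+_ noLoop edgesAtV) edgesAwayFromV)
  where
  inside : Fin (suc m) × Fin (suc m) → Bool
  inside (u , w) = (u <ᵇ w) ∧ adj G u w ∧ C u ∧ C w
  noLoop : 𝟙 ((v <ᵇ v) ∧ adj G v v ∧ C v ∧ C v) ≡ 0
  noLoop = cong 𝟙 (cong (_∧ (adj G v v ∧ C v ∧ C v)) (<ᵇ-irrefl v))
  edgesAtV : ∑ℕ (λ k → 𝟙 (inside (v , punchIn v k)) + 𝟙 (inside (punchIn v k , v))) (allFin m)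
           ≡ ∑ℕ (λ k → 𝟙 (adj G v (punchIn v k) ∧ C v ∧ C (punchIn v k))) (allFin m)
  edgesAtV = ∑ℕ-cong (λ k → begin
    𝟙 ((v <ᵇ punchIn v k) ∧ adj G v (punchIn v k) ∧ C v ∧ C (punchIn v k))
      + 𝟙 ((punchIn v k <ᵇ v) ∧ adj G (punchIn v k) v ∧ C (punchIn v k) ∧ C v)
        ≡⟨ cong₂ (λ a b → 𝟙 ((v <ᵇ punchIn v k) ∧ adj G v (punchIn v k) ∧ C v ∧ C (punchIn v k))
                          + 𝟙 ((punchIn v k <ᵇ v) ∧ a ∧ b))
                 (adj-sym G (punchIn v k) v) (Boolₚ.∧-comm (C (punchIn v k)) (C v)) ⟩
    𝟙 ((v <ᵇ punchIn v k) ∧ adj G v (punchIn v k) ∧ C v ∧ C (punchIn v k))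
      + 𝟙 ((punchIn v k <ᵇ v) ∧ adj G v (punchIn v k) ∧ C v ∧ C (punchIn v k))
        ≡⟨ 𝟙-<ᵇ-split (Finₚ.punchInᵢ≢i v k ∘ sym) (adj G v (punchIn v k) ∧ C v ∧ C (punchIn v k)) ⟩
    𝟙 (adj G v (punchIn v k) ∧ C v ∧ C (punchIn v k)) ∎) (allFin m)
    where open ≡-Reasoning
  edgesAwayFromV : count (inside ∘ map× (punchIn v) (punchIn v)) (pairs m) ≡ edgesIn (delete G v) (C ∘ punchIn v)
  edgesAwayFromV = count-cong (λ { (i , k) →
    cong (_∧ (adj G (punchIn v i) (punchIn v k) ∧ C (punchIn v i) ∧ C (punchIn v k))) (punchIn-<ᵇ v i k) }) (pairs m)

edgesIn-delete-outside : ∀ {m} (G : Graph (suc m)) C v → C v ≡ false →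
                         edgesIn G C ≡ edgesIn (delete G v) (C ∘ punchIn v)
edgesIn-delete-outside {m} G C v Cv = trans (edgesIn-delete G C v) (cong (_+ edgesIn (delete G v) (C ∘ punchIn v))
  (∑ℕ-zero (λ k → 𝟙 (adj G v (punchIn v k) ∧ C v ∧ C (punchIn v k))) noNeighbourInside (allFin m)))
  where
  noNeighbourInside : ∀ k → 𝟙 (adj G v (punchIn v k) ∧ C v ∧ C (punchIn v k)) ≡ 0
  noNeighbourInside k rewrite Cv = cong 𝟙 (Boolₚ.∧-zeroʳ (adj G v (punchIn v k)))

edgesIn-delete-inside : ∀ {m} (G : Graph (suc m)) C v → Closed G C → C v ≡ true →
                        edgesIn G C ≡ deg G v + edgesIn (delete G v) (C ∘ punchIn v)
edgesIn-delete-inside {m} G C v closed Cv = trans (edgesIn-delete G C v) (cong (_+ edgesIn (delete G v) (C ∘ punchIn v))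
  (trans (∑ℕ-cong neighbourInside (allFin m)) (sym (deg-punchIn G v))))
  where
  neighbourInside : ∀ k → 𝟙 (adj G v (punchIn v k) ∧ C v ∧ C (punchIn v k)) ≡ 𝟙 (adj G v (punchIn v k))
  neighbourInside k rewrite Cv with adj G v (punchIn v k) in vk
  ... | false = refl
  ... | true  = cong 𝟙 (closed v (punchIn v k) Cv vk)

A-1≡0-oddClosed : ∀ n (G : Graph n) (C : Fin n → Bool) → Closed G C → Odd (edgesIn G C) → A-1 (orient G) ≡ 0ℤ
A-1≡0-oddClosed zero    G C closed ()
A-1≡0-oddClosed (suc m) G C closed odd = A-1≡0 (orient G) (orient-loopless G) vanishesAt
  where
  IH : ∀ v → Odd (edgesIn (delete G v) (C ∘ punchIn v)) → A-1 (deleteᴰ (orient G) v) ≡ 0ℤ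
  IH v odd′ = trans (A-1-delete G v) (A-1≡0-oddClosed m (delete G v) (C ∘ punchIn v) (Closed-delete G closed v) odd′)
  vanishesAt : ∀ v → Odd (outdeg (orient G) v + indeg (orient G) v) ⊎ A-1 (deleteᴰ (orient G) v) ≡ 0ℤ
  vanishesAt v with C v in Cv | parity (deg G v)
  ... | false | _            = inj₂ (IH v (subst Odd (edgesIn-delete-outside G C v Cv) odd))
  ... | true  | inj₂ oddDeg  = inj₁ (subst Odd (sym (outdeg+indeg≡deg G v)) oddDeg)
  ... | true  | inj₁ evenDeg = inj₂ (IH v (even+odd⇒odd (deg G v) _ evenDeg
                                             (subst Odd (edgesIn-delete-inside G C v closed Cv) odd)))

ν≡0-oddComponent : ∀ n (G : Graph n) → HasOddComponent G → ν G ≡ 0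
ν≡0-oddComponent n G (C , (_ , closed , _) , odd) = cong ∣_∣ (A-1≡0-oddClosed n G C closed odd)

-- Universal vertices
Universal : ∀ {m} → Digraph (suc m) → Fin (suc m) → Set
Universal {m} D v = ∀ i → 𝟙 (D v (punchIn v i)) + 𝟙 (D (punchIn v i) v) ≡ 1

module Exchange {m} (D : Digraph (suc (suc m))) (v : Fin (suc (suc m))) (i : Fin (suc m)) where

  u : Fin (suc (suc m))
  u = punchIn v i

  u≢v : u ≢ v
  u≢v = Finₚ.punchInᵢ≢i v i

  v′ : Fin (suc m)
  v′ = punchOut u≢v

  punchIn-v′ : punchIn u v′ ≡ v
  punchIn-v′ = Finₚ.punchIn-punchOut u≢v

  deleteᴰ-exchange : ∀ k l → deleteᴰ (deleteᴰ D u) v′ k l ≡ deleteᴰ (deleteᴰ D v) i k l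
  deleteᴰ-exchange k l = cong₂ D (punchIn-exchange v i u≢v k) (punchIn-exchange v i u≢v l)

  universal-exchange : Universal D v → Universal (deleteᴰ D u) v′
  universal-exchange universal k =
    trans (cong₂ (λ a b → 𝟙 (D a b) + 𝟙 (D b a)) punchIn-v′ (punchIn-exchange v i u≢v k)) (universal (punchIn i k))

  outdeg-u : outdeg D u ≡ 𝟙 (D u v) + outdeg (deleteᴰ D v) i
  outdeg-u = count-punchIn v (D u)

  outdeg-v : outdeg D v ≡ 𝟙 (D v u) + outdeg (deleteᴰ D u) v′
  outdeg-v = trans (count-punchIn u (D v))
                   (cong (λ w → 𝟙 (D v u) + count (λ k → D w (punchIn u k)) (allFin (suc m))) (sym punchIn-v′))

  term-exchange : Universal D v →
    A-1 (deleteᴰ D u) ≡ sign (outdeg (deleteᴰ D u) v′) *ℤ A-1 (deleteᴰ (deleteᴰ D u) v′) →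
    sign (outdeg D u) *ℤ A-1 (deleteᴰ D u) ≡
      - sign (outdeg D v) *ℤ (sign (outdeg (deleteᴰ D v) i) *ℤ A-1 (deleteᴰ (deleteᴰ D v) i))
  term-exchange universal A-1-u = begin
    sign (outdeg D u) *ℤ A-1 (deleteᴰ D u)
      ≡⟨ cong₂ _*ℤ_ (cong sign outdeg-u) (trans A-1-u (cong (sign Y *ℤ_) (A-1-cong deleteᴰ-exchange))) ⟩
    sign (𝟙 (D u v) + X) *ℤ (sign Y *ℤ Z)
      ≡⟨ sign-exchange (𝟙 (D u v)) (𝟙 (D v u)) X Y Z (trans (ℕₚ.+-comm (𝟙 (D u v)) (𝟙 (D v u))) (universal i)) ⟩
    - (sign (𝟙 (D v u) + Y) *ℤ (sign X *ℤ Z))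
      ≡⟨ cong (λ n → - (sign n *ℤ (sign X *ℤ Z))) outdeg-v ⟨
    - (sign (outdeg D v) *ℤ (sign X *ℤ Z))
      ≡⟨ ℤₚ.neg-distribˡ-* (sign (outdeg D v)) (sign X *ℤ Z) ⟩
    - sign (outdeg D v) *ℤ (sign X *ℤ Z) ∎
    where
    open ≡-Reasoning
    X Y : ℕ
    X = outdeg (deleteᴰ D v) i
    Y = outdeg (deleteᴰ D u) v′
    Z : ℤ
    Z = A-1 (deleteᴰ (deleteᴰ D v) i)

A-1-universal : ∀ m (D : Digraph (suc m)) → Loopless D → ∀ v → Universal D v →
  (Even (suc m) → A-1 D ≡ 0ℤ) × (Odd (suc m) → A-1 D ≡ sign (outdeg D v) *ℤ A-1 (deleteᴰ D v))
A-1-universal zero    D loopless v _ = (λ ()) , λ _ →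
  trans (A-1-top D loopless) (trans (∑-allFin-punchIn v term) (ℤₚ.+-identityʳ (term v)))
  where
  term : Fin 1 → ℤ
  term u = sign (outdeg D u) *ℤ A-1 (deleteᴰ D u)
A-1-universal (suc m) D loopless v universal = evenCase , oddCase
  where
  term : Fin (suc (suc m)) → ℤ
  term u = sign (outdeg D u) *ℤ A-1 (deleteᴰ D u)

  s : ℤ
  s = sign (outdeg D v)

  A-1-split : A-1 D ≡ term v +ℤ ∑ (term ∘ punchIn v) (allFin (suc m))
  A-1-split = trans (A-1-top D loopless) (∑-allFin-punchIn v term)

  IH : ∀ i → let open Exchange D v i in
    (Even (suc m) → A-1 (deleteᴰ D u) ≡ 0ℤ) ×
    (Odd (suc m) → A-1 (deleteᴰ D u) ≡ sign (outdeg (deleteᴰ D u) v′) *ℤ A-1 (deleteᴰ (deleteᴰ D u) v′))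
  IH i = let open Exchange D v i in
    A-1-universal m (deleteᴰ D u) (loopless ∘ punchIn u) v′ (universal-exchange universal)

  oddCase : Odd (suc (suc m)) → A-1 D ≡ s *ℤ A-1 (deleteᴰ D v)
  oddCase odd = trans A-1-split (trans (cong (term v +ℤ_) (∑-zero (term ∘ punchIn v) othersVanish (allFin (suc m))))
                                       (ℤₚ.+-identityʳ (term v)))
    where
    othersVanish : ∀ i → term (punchIn v i) ≡ 0ℤ
    othersVanish i = trans (cong (sign (outdeg D (punchIn v i)) *ℤ_) (proj₁ (IH i) (odd⇒even-suc m odd)))
                           (ℤₚ.*-zeroʳ (sign (outdeg D (punchIn v i))))

  evenCase : Even (suc (suc m)) → A-1 D ≡ 0ℤ
  evenCase even = begin
    A-1 D                                               ≡⟨ A-1-split ⟩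
    term v +ℤ ∑ (term ∘ punchIn v) (allFin (suc m))     ≡⟨ cong (term v +ℤ_) (∑-cong exchanged (allFin (suc m))) ⟩
    term v +ℤ ∑ (λ i → - s *ℤ termᵥ i) (allFin (suc m)) ≡⟨ cong (term v +ℤ_) (∑-*ˡ (- s) termᵥ (allFin (suc m))) ⟩
    term v +ℤ - s *ℤ ∑ termᵥ (allFin (suc m))           ≡⟨ cong (λ a → term v +ℤ - s *ℤ a) A-1ᵥ ⟨
    s *ℤ A-1 (deleteᴰ D v) +ℤ - s *ℤ A-1 (deleteᴰ D v)  ≡⟨ ℤₚ.*-distribʳ-+ (A-1 (deleteᴰ D v)) s (- s) ⟨
    (s +ℤ - s) *ℤ A-1 (deleteᴰ D v)                     ≡⟨ cong (_*ℤ A-1 (deleteᴰ D v)) (ℤₚ.+-inverseʳ s) ⟩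
    0ℤ *ℤ A-1 (deleteᴰ D v)                             ≡⟨ ℤₚ.*-zeroˡ (A-1 (deleteᴰ D v)) ⟩
    0ℤ                                                  ∎
    where
    open ≡-Reasoning
    termᵥ : Fin (suc m) → ℤ
    termᵥ i = sign (outdeg (deleteᴰ D v) i) *ℤ A-1 (deleteᴰ (deleteᴰ D v) i)
    A-1ᵥ : A-1 (deleteᴰ D v) ≡ ∑ termᵥ (allFin (suc m))
    A-1ᵥ = A-1-top (deleteᴰ D v) (loopless ∘ punchIn v)
    exchanged : ∀ i → term (punchIn v i) ≡ - s *ℤ termᵥ i
    exchanged i = Exchange.term-exchange D v i universal (proj₂ (IH i) (even⇒odd-suc m even))

universal-orient : ∀ {m} (G : Graph (suc m)) v → deg G v ≡ m → Universal (orient G) v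
universal-orient {m} G v deg≡m i =
  trans (orient-arcs G (Finₚ.punchInᵢ≢i v i ∘ sym)) (cong 𝟙 (count≡length⇒all _ (allFin m) full (∈-allFin i)))
  where
  full : count (adj G v ∘ punchIn v) (allFin m) ≡ length (allFin m)
  full = begin
    count (adj G v ∘ punchIn v) (allFin m)                     ≡⟨ cong (_+ count (adj G v ∘ punchIn v) (allFin m))
                                                                       (cong 𝟙 (adj-irrefl G v)) ⟨
    𝟙 (adj G v v) + count (adj G v ∘ punchIn v) (allFin m)     ≡⟨ count-punchIn v (adj G v) ⟨
    deg G v                                                    ≡⟨ deg≡m ⟩
    m                                                          ≡⟨ Listₚ.length-tabulate (λ k → k) ⟨
    length (allFin m)                                          ∎
    where open ≡-Reasoning

ν-universal : ∀ m (G : Graph (suc m)) v → deg G v ≡ m →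
              (Even (suc m) → ν G ≡ 0) × (Odd (suc m) → ν G ≡ ν (delete G v))
ν-universal m G v deg≡m = (λ even → cong ∣_∣ (proj₁ A-1-orient even))
                        , (λ odd → trans (cong ∣_∣ (proj₂ A-1-orient odd))
                                         (trans (∣sign*x∣≡∣x∣ (outdeg (orient G) v) (A-1 (deleteᴰ (orient G) v)))
                                                (cong ∣_∣ (A-1-delete G v))))
  where
  A-1-orient : (Even (suc m) → A-1 (orient G) ≡ 0ℤ) ×
               (Odd (suc m) → A-1 (orient G) ≡ sign (outdeg (orient G) v) *ℤ A-1 (deleteᴰ (orient G) v))
  A-1-orient = A-1-universal m (orient G) (orient-loopless G) v (universal-orient G v deg≡m)

corollary3p7 : (∀ (n : ℕ) (G : Graph n) → HasOddComponent G → ν G ≡ 0)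
    × (∀ (m : ℕ) (G : Graph (suc m)) → (∀ v → Odd (deg G v)) → ν G ≡ 0)
    × (∀ (m : ℕ) (G : Graph (suc m)) (v : Fin (suc m)) → deg G v ≡ m →
         (Even (suc m) → ν G ≡ 0) × (Odd (suc m) → ν G ≡ ν (delete G v)))
corollary3p7 = ν≡0-oddComponent , ν≡0-oddDegrees , ν-universal
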